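{- Let $p\ge 1$, $q\ge 2$, and let $E \in \{0,1\}^{p \times q}$ and $M \in \mathbb{Z}_{\ge 0}^{p \times q}$ be row-normalized matrices. If $\operatorname{colweight}(M,0)=\operatorname{colweight}(E,0)$, $\operatorname{weight}(M)=\operatorname{weight}(E)$, $\operatorname{rowsum}(M)=\operatorname{rowsum}(E)$, and $\operatorname{code}(M)=\operatorname{code}(E)$, then $M=E$.
   Context: Matrices $M=(M[i,j])_{0\le i\le p-1,\,0\le j\le q-1}$ with non-negative integer entries are indexed from $0$. Define $\operatorname{colweight}(M,j)=\sum_{i=0}^{p-1}M[i,j]$; $\operatorname{weight}(M)=\sum_{i=0}^{p-1}\sum_{j=0}^{q-1}M[i,j]$; $\operatorname{rowcode}(M,i)=-M[i,0]+\sum_{j=1}^{q-1}2^j\cdot M[i,j]$; $\operatorname{rowsum}(M)=\sum_{i=0}^{p-1}\operatorname{rowcode}(M,i)$; $\operatorname{code}(M)=\sum_{i=0}^{p-1}(2^q-1)^i\cdot\operatorname{rowcode}(M,i)$. A matrix $M\in\mathbb{Z}_{\ge0}^{p\times q}$ is called row-normalized if $\operatorname{rowcode}(M,i)\ge 0$ for all $0\le i\le p-1$. -}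

module Defs where

open import Data.Nat as ℕ using (ℕ; zero; suc)
open import Data.Fin as F using (Fin; toℕ)
open import Data.Integer as ℤ using (ℤ; +_; -_)

Matrix : ℕ → ℕ → Set
Matrix p q = Fin p → Fin q → ℕ

sumℕ : ∀ {n} → (Fin n → ℕ) → ℕ
sumℕ {zero} f = 0
sumℕ {suc n} f = f F.zero ℕ.+ sumℕ (λ i → f (F.suc i))

sumℤ : ∀ {n} → (Fin n → ℤ) → ℤ
sumℤ {zero} f = + 0
sumℤ {suc n} f = f F.zero ℤ.+ sumℤ (λ i → f (F.suc i))

colweight : ∀ {p q} → Matrix p q → Fin q → ℕ
colweight M j = sumℕ (λ i → M i j)

weight : ∀ {p q} → Matrix p q → ℕ
weight M = sumℕ (λ i → sumℕ (λ j → M i j))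

colCoeff : ∀ {q} → Fin q → ℤ
colCoeff F.zero = - (+ 1)
colCoeff (F.suc j) = + (2 ℕ.^ suc (toℕ j))

rowcode : ∀ {p q} → Matrix p q → Fin p → ℤ
rowcode M i = sumℤ (λ j → colCoeff j ℤ.* + M i j)

rowsum : ∀ {p q} → Matrix p q → ℤ
rowsum M = sumℤ (λ i → rowcode M i)

code : ∀ {p q} → Matrix p q → ℤ
code {q = q} M =
  sumℤ (λ i → ((+ (2 ℕ.^ q)) ℤ.- + 1) ℤ.^ toℕ i ℤ.* rowcode M i)

RowNormalized : ∀ {p q} → Matrix p q → Set
RowNormalized M = ∀ i → + 0 ℤ.≤ rowcode M i

Binary : ∀ {p q} → Matrix p q → Set
Binary M = ∀ i j → M i j ℕ.≤ 1

-- colweight(M,0); for q = 0 there is no column 0 (value 0, never used since q ≥ 2)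
colweight0 : ∀ {p q} → Matrix p q → ℕ
colweight0 {q = zero} M = 0
colweight0 {q = suc q} M = colweight M F.zero

module Submission where

-- Row-normalisation makes each rowcode a natural number r_i, so code(M) is the base-(2^q − 1)
-- numeral with digits r_i and rowsum(M) is its digit sum.  A base-b representation with
-- arbitrary natural digits can only gain digit sum relative to the standard one (trading a
-- digit ≥ b for a carry saves b − 1), so the standard expansion is the unique one of minimal
-- digit sum.  For binary E every r_i is at most 2^q − 2, hence E's rowcodes are the standard
-- digits and the rowcodes of M and E agree.  Within a row, r_i + M[i,0] = 2·v_i where v_i is
-- the binary value of the remaining entries; parity and the equal column-0 weights force the
-- first columns to agree, and the same minimal-digit-sum argument in base 2, together with the
-- equal total weights, forces the remaining entries to agree.

open import Data.Nat using (ℕ; zero; suc; _+_; _*_; _∸_; _^_; _≤_; _<_; _≥_; z≤n; s≤s; NonZero)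
open import Data.Nat.Properties
open import Data.Nat.DivMod using (_%_; _/_; m≡m%n+[m/n]*n; m%n<n; m%n≤m; m<n⇒m%n≡m; [m+kn]%n≡m%n)
open import Data.Nat.Tactic.RingSolver using (solve-∀)
open import Data.Fin as F using (Fin; toℕ)
open import Data.Integer as ℤ using (ℤ; +_; -_)
import Data.Integer.Properties as ℤP
import Data.Integer.Tactic.RingSolver as ℤSolver
open import Data.Vec.Functional using (head; tail)
open import Data.Product using (_×_; _,_; proj₁; proj₂)
open import Data.Sum using (inj₁; inj₂)
open import Data.Empty using (⊥-elim)
open import Function using (_∘_)
open import Relation.Binary.PropositionalEquality
open import Defs

sumℕ-cong : ∀ {n} {f g : Fin n → ℕ} → (∀ i → f i ≡ g i) → sumℕ f ≡ sumℕ g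
sumℕ-cong {zero}  f≡g = refl
sumℕ-cong {suc n} f≡g = cong₂ _+_ (f≡g F.zero) (sumℕ-cong (f≡g ∘ F.suc))

sumℤ-cong : ∀ {n} {f g : Fin n → ℤ} → (∀ i → f i ≡ g i) → sumℤ f ≡ sumℤ g
sumℤ-cong {zero}  f≡g = refl
sumℤ-cong {suc n} f≡g = cong₂ ℤ._+_ (f≡g F.zero) (sumℤ-cong (f≡g ∘ F.suc))

sumℤ-+ : ∀ {n} (f : Fin n → ℕ) → sumℤ (λ i → + f i) ≡ + sumℕ f
sumℤ-+ {zero}  f = refl
sumℤ-+ {suc n} f = begin
  + head f ℤ.+ sumℤ (λ i → + tail f i) ≡⟨ cong (ℤ._+_ (+ head f)) (sumℤ-+ (tail f)) ⟩
  + head f ℤ.+ + sumℕ (tail f)         ≡⟨ ℤP.pos-+ (head f) (sumℕ (tail f)) ⟨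
  + sumℕ f                              ∎
  where open ≡-Reasoning

sumℕ-*ˡ : ∀ {n} m (f : Fin n → ℕ) → sumℕ (λ i → m * f i) ≡ m * sumℕ f
sumℕ-*ˡ {zero}  m f = sym (*-zeroʳ m)
sumℕ-*ˡ {suc n} m f = begin
  m * head f + sumℕ (λ i → m * tail f i) ≡⟨ cong (_+_ (m * head f)) (sumℕ-*ˡ m (tail f)) ⟩
  m * head f + m * sumℕ (tail f)         ≡⟨ *-distribˡ-+ m (head f) (sumℕ (tail f)) ⟨
  m * sumℕ f                              ∎
  where open ≡-Reasoning

sumℕ-mono-≤ : ∀ {n} {f g : Fin n → ℕ} → (∀ i → f i ≤ g i) → sumℕ f ≤ sumℕ g
sumℕ-mono-≤ {zero}  f≤g = z≤n
sumℕ-mono-≤ {suc n} f≤g = +-mono-≤ (f≤g F.zero) (sumℕ-mono-≤ (f≤g ∘ F.suc))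

≤-sumℕ-≡⇒≡ : ∀ {n} {f g : Fin n → ℕ} → (∀ i → f i ≤ g i) → sumℕ f ≡ sumℕ g → ∀ i → f i ≡ g i
≤-sumℕ-≡⇒≡ {suc n} {f} {g} f≤g Σf≡Σg = λ
  { F.zero    → head≡
  ; (F.suc i) → ≤-sumℕ-≡⇒≡ (f≤g ∘ F.suc) tail≡ i
  }
  where
  head≡ : head f ≡ head g
  head≡ = ≤-antisym (f≤g F.zero) (+-cancelʳ-≤ (sumℕ (tail f)) _ _ (begin
    head g + sumℕ (tail f) ≤⟨ +-monoʳ-≤ (head g) (sumℕ-mono-≤ (f≤g ∘ F.suc)) ⟩
    sumℕ g                 ≡⟨ Σf≡Σg ⟨
    sumℕ f                 ∎))
    where open ≤-Reasoning
  tail≡ : sumℕ (tail f) ≡ sumℕ (tail g)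
  tail≡ = +-cancelˡ-≡ (head f) _ _ (trans Σf≡Σg (cong (_+ sumℕ (tail g)) (sym head≡)))

+-*-≡⇒%-≡ : ∀ {b} .{{_ : NonZero b}} x y m n → x + m * b ≡ y + n * b → x % b ≡ y % b
+-*-≡⇒%-≡ {b} x y m n eq = begin
  x % b           ≡⟨ [m+kn]%n≡m%n x m b ⟨
  (x + m * b) % b ≡⟨ cong (_% b) eq ⟩
  (y + n * b) % b ≡⟨ [m+kn]%n≡m%n y n b ⟩
  y % b           ∎
  where open ≡-Reasoning

divMod-unique : ∀ {b} .{{_ : NonZero b}} {r₁ r₂} k₁ k₂ → r₁ < b → r₂ < b →
                r₁ + k₁ * b ≡ r₂ + k₂ * b → r₁ ≡ r₂ × k₁ ≡ k₂
divMod-unique {b} {r₁} {r₂} k₁ k₂ r₁<b r₂<b eq = r₁≡r₂ , k₁≡k₂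
  where
  open ≡-Reasoning
  r₁≡r₂ : r₁ ≡ r₂
  r₁≡r₂ = begin
    r₁     ≡⟨ m<n⇒m%n≡m r₁<b ⟨
    r₁ % b ≡⟨ +-*-≡⇒%-≡ r₁ r₂ k₁ k₂ eq ⟩
    r₂ % b ≡⟨ m<n⇒m%n≡m r₂<b ⟩
    r₂     ∎
  k₁≡k₂ : k₁ ≡ k₂
  k₁≡k₂ = *-cancelʳ-≡ k₁ k₂ b (+-cancelˡ-≡ r₁ _ _ (trans eq (cong (_+ k₂ * b) (sym r₁≡r₂))))

carry-split : ∀ {b} .{{_ : NonZero b}} s v d₀ w → d₀ < b → s + b * v ≡ d₀ + b * w →
              s % b ≡ d₀ × s / b + v ≡ w
carry-split {b} s v d₀ w d₀<b eq = divMod-unique (s / b + v) w (m%n<n s b) d₀<b (begin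
  s % b + (s / b + v) * b     ≡⟨ regroup (s % b) (s / b) v b ⟩
  (s % b + s / b * b) + b * v ≡⟨ cong (_+ b * v) (m≡m%n+[m/n]*n s b) ⟨
  s + b * v                   ≡⟨ eq ⟩
  d₀ + b * w                  ≡⟨ cong (_+_ d₀) (*-comm b w) ⟩
  d₀ + w * b                  ∎)
  where
  open ≡-Reasoning
  regroup : ∀ r k v b → r + (k + v) * b ≡ (r + k * b) + b * v
  regroup = solve-∀

≡-mod⇒≤ : ∀ {b} .{{_ : NonZero b}} {x y} m n → x < b → x + m * b ≡ y + n * b → x ≤ y
≡-mod⇒≤ {b} {x} {y} m n x<b eq = begin
  x     ≡⟨ m<n⇒m%n≡m x<b ⟨
  x % b ≡⟨ +-*-≡⇒%-≡ x y m n eq ⟩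
  y % b ≤⟨ m%n≤m y b ⟩
  y     ∎
  where open ≤-Reasoning

m*n≤m⇒m≡0 : ∀ {m n} → 1 < n → m * n ≤ m → m ≡ 0
m*n≤m⇒m≡0 {zero}      1<n _     = refl
m*n≤m⇒m≡0 {suc m} {n} 1<n m*n≤m = ⊥-elim (<⇒≱ (m<m*n (suc m) n 1<n) m*n≤m)

fromDigits : ℕ → ∀ {n} → (Fin n → ℕ) → ℕ
fromDigits b {zero}  d = 0
fromDigits b {suc n} d = head d + b * fromDigits b (tail d)

Digits : ℕ → ∀ {n} → (Fin n → ℕ) → Set
Digits b d = ∀ i → d i < b

sumℕ-powers≡fromDigits : ∀ {n} b (d : Fin n → ℕ) → sumℕ (λ k → b ^ toℕ k * d k) ≡ fromDigits b d
sumℕ-powers≡fromDigits {zero}  b d = refl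
sumℕ-powers≡fromDigits {suc n} b d = cong₂ _+_ (*-identityˡ (head d)) (begin
  sumℕ (λ k → b * b ^ toℕ k * tail d k)   ≡⟨ sumℕ-cong (λ k → *-assoc b (b ^ toℕ k) (tail d k)) ⟩
  sumℕ (λ k → b * (b ^ toℕ k * tail d k)) ≡⟨ sumℕ-*ˡ b (λ k → b ^ toℕ k * tail d k) ⟩
  b * sumℕ (λ k → b ^ toℕ k * tail d k)   ≡⟨ cong (b *_) (sumℕ-powers≡fromDigits b (tail d)) ⟩
  b * fromDigits b (tail d)               ∎)
  where open ≡-Reasoning

fromDigits-< : ∀ {n b} {d : Fin n → ℕ} → Digits b d → fromDigits b d < b ^ n
fromDigits-< {zero}          d<b = s≤s z≤n
fromDigits-< {suc n} {b} {d} d<b = begin-strict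
  head d + b * v <⟨ +-monoˡ-< (b * v) (d<b F.zero) ⟩
  b + b * v      ≡⟨ *-suc b v ⟨
  b * suc v      ≤⟨ *-monoʳ-≤ b (fromDigits-< (d<b ∘ F.suc)) ⟩
  b * b ^ n      ∎
  where
  open ≤-Reasoning
  v = fromDigits b (tail d)

addHead : ∀ {n} → ℕ → (Fin n → ℕ) → Fin n → ℕ
addHead t d F.zero    = t + d F.zero
addHead t d (F.suc i) = d (F.suc i)

addHead-zero : ∀ {n} (d : Fin n → ℕ) i → addHead 0 d i ≡ d i
addHead-zero d F.zero    = refl
addHead-zero d (F.suc i) = refl

-- The carry t entering the lowest position is what makes the induction go through: the lowest
-- digit t + c₀ of the left side is split as d₀ + t′·b, and t′ is carried to the next position.
digits-carry : ∀ {b n} → 2 ≤ b → (t : ℕ) (c d : Fin n → ℕ) → Digits b d →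
               t + fromDigits b c ≡ fromDigits b d → t + sumℕ c ≤ sumℕ d →
               t + sumℕ c ≡ sumℕ d × (∀ i → addHead t c i ≡ d i)
digits-carry {n = zero} _ t c d _ value≡ _ = value≡ , λ ()
digits-carry {b} {suc n} 2≤b@(s≤s (s≤s _)) t c d d<b value≡ sum≤ = sum≡ , entries≡
  where
  open ≡-Reasoning
  s  = t + head c
  t′ = s / b
  vc = fromDigits b (tail c)
  vd = fromDigits b (tail d)
  Σc = sumℕ (tail c)
  Σd = sumℕ (tail d)

  s-split : s ≡ s % b + t′ * b
  s-split = m≡m%n+[m/n]*n s b

  split : s % b ≡ head d × t′ + vc ≡ vd
  split = carry-split s vc (head d) vd (d<b F.zero) (trans (+-assoc t (head c) (b * vc)) value≡)

  tail-sum≤ : t′ * b + Σc ≤ Σd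
  tail-sum≤ = +-cancelˡ-≤ (s % b) _ _ (≤-trans (≤-reflexive regroup-sum) (≤-trans sum≤ (≤-reflexive lowest-sum)))
    where
    regroup-sum : s % b + (t′ * b + Σc) ≡ t + sumℕ c
    regroup-sum = begin
      s % b + (t′ * b + Σc) ≡⟨ +-assoc (s % b) (t′ * b) Σc ⟨
      (s % b + t′ * b) + Σc ≡⟨ cong (_+ Σc) s-split ⟨
      s + Σc                ≡⟨ +-assoc t (head c) Σc ⟩
      t + sumℕ c            ∎
    lowest-sum : head d + Σd ≡ s % b + Σd
    lowest-sum = cong (_+ Σd) (sym (proj₁ split))

  ih : t′ + Σc ≡ Σd × (∀ i → addHead t′ (tail c) i ≡ tail d i)
  ih = digits-carry 2≤b t′ (tail c) (tail d) (d<b ∘ F.suc) (proj₂ split)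
                    (≤-trans (+-monoˡ-≤ Σc (m≤m*n t′ b)) tail-sum≤)

  t′≡0 : t′ ≡ 0
  t′≡0 = m*n≤m⇒m≡0 2≤b (+-cancelʳ-≤ Σc _ _ (≤-trans tail-sum≤ (≤-reflexive (sym (proj₁ ih)))))

  lowest≡ : s ≡ head d
  lowest≡ = begin
    s              ≡⟨ s-split ⟩
    s % b + t′ * b ≡⟨ cong (λ k → s % b + k * b) t′≡0 ⟩
    s % b + 0      ≡⟨ +-identityʳ (s % b) ⟩
    s % b          ≡⟨ proj₁ split ⟩
    head d         ∎

  sum≡ : t + sumℕ c ≡ sumℕ d
  sum≡ = begin
    t + (head c + Σc) ≡⟨ +-assoc t (head c) Σc ⟨
    s + Σc            ≡⟨ cong₂ _+_ lowest≡ (subst (λ k → k + Σc ≡ Σd) t′≡0 (proj₁ ih)) ⟩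
    head d + Σd       ∎

  entries≡ : ∀ i → addHead t c i ≡ d i
  entries≡ F.zero    = lowest≡
  entries≡ (F.suc i) = begin
    tail c i             ≡⟨ addHead-zero (tail c) i ⟨
    addHead 0 (tail c) i ≡⟨ subst (λ k → addHead k (tail c) i ≡ tail d i) t′≡0 (proj₂ ih i) ⟩
    tail d i             ∎

digits-unique : ∀ {b n} {c d : Fin n → ℕ} → 2 ≤ b → Digits b d →
                fromDigits b c ≡ fromDigits b d → sumℕ c ≤ sumℕ d → ∀ i → c i ≡ d i
digits-unique {c = c} {d} 2≤b d<b value≡ sum≤ i =
  trans (sym (addHead-zero c i)) (proj₂ (digits-carry 2≤b 0 c d d<b value≡ sum≤) i)

digitSum-minimal : ∀ {b n} {c d : Fin n → ℕ} → 2 ≤ b → Digits b d →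
                   fromDigits b c ≡ fromDigits b d → sumℕ d ≤ sumℕ c
digitSum-minimal {c = c} {d} 2≤b d<b value≡ with ≤-total (sumℕ d) (sumℕ c)
... | inj₁ Σd≤Σc = Σd≤Σc
... | inj₂ Σc≤Σd = ≤-reflexive (sym (proj₁ (digits-carry 2≤b 0 c d d<b value≡ Σc≤Σd)))

rowValue : ∀ {p q} → Matrix p (suc q) → Fin p → ℕ
rowValue X i = fromDigits 2 (tail (X i))

rowcode-+-col0 : ∀ {p q} (X : Matrix p (suc q)) i →
                 rowcode X i ℤ.+ + X i F.zero ≡ + (2 * rowValue X i)
rowcode-+-col0 X i = trans (cancel (+ X i F.zero) tailCode) weighted
  where
  open ≡-Reasoning
  cancel : ∀ a w → (- + 1) ℤ.* a ℤ.+ w ℤ.+ a ≡ w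
  cancel = ℤSolver.solve-∀
  tailCode = sumℤ (λ j → + (2 ^ suc (toℕ j)) ℤ.* + X i (F.suc j))
  weighted : tailCode ≡ + (2 * rowValue X i)
  weighted = begin
    tailCode ≡⟨ sumℤ-cong (λ j → ℤP.pos-* (2 ^ suc (toℕ j)) (X i (F.suc j))) ⟨
    sumℤ (λ j → + (2 ^ suc (toℕ j) * X i (F.suc j)))     ≡⟨ sumℤ-+ (λ j → 2 ^ suc (toℕ j) * X i (F.suc j)) ⟩
    + sumℕ (λ j → 2 * 2 ^ toℕ j * X i (F.suc j))         ≡⟨ cong +_ (sumℕ-cong (λ j → *-assoc 2 (2 ^ toℕ j) (X i (F.suc j)))) ⟩
    + sumℕ (λ j → 2 * (2 ^ toℕ j * X i (F.suc j)))       ≡⟨ cong +_ (sumℕ-*ˡ 2 (λ j → 2 ^ toℕ j * X i (F.suc j))) ⟩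
    + (2 * sumℕ (λ j → 2 ^ toℕ j * X i (F.suc j)))       ≡⟨ cong (λ v → + (2 * v)) (sumℕ-powers≡fromDigits 2 (tail (X i))) ⟩
    + (2 * rowValue X i)                                  ∎

rowcodeℕ : ∀ {p q} → Matrix p q → Fin p → ℕ
rowcodeℕ X i = ℤ.∣ rowcode X i ∣

+rowcodeℕ : ∀ {p q} (X : Matrix p q) → RowNormalized X → ∀ i → + rowcodeℕ X i ≡ rowcode X i
+rowcodeℕ X X≥0 i = ℤP.0≤i⇒+∣i∣≡i (X≥0 i)

rowcodeℕ-+-col0 : ∀ {p q} (X : Matrix p (suc q)) → RowNormalized X →
                  ∀ i → rowcodeℕ X i + X i F.zero ≡ 2 * rowValue X i
rowcodeℕ-+-col0 X X≥0 i = ℤP.+-injective (begin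
  + (rowcodeℕ X i + X i F.zero)       ≡⟨ ℤP.pos-+ (rowcodeℕ X i) (X i F.zero) ⟩
  + rowcodeℕ X i ℤ.+ + X i F.zero     ≡⟨ cong (ℤ._+ + X i F.zero) (+rowcodeℕ X X≥0 i) ⟩
  rowcode X i ℤ.+ + X i F.zero        ≡⟨ rowcode-+-col0 X i ⟩
  + (2 * rowValue X i)                ∎)
  where open ≡-Reasoning

pos-^ : ∀ m n → (+ m) ℤ.^ n ≡ + (m ^ n)
pos-^ m zero    = refl
pos-^ m (suc n) = trans (cong (ℤ._*_ (+ m)) (pos-^ m n)) (sym (ℤP.pos-* m (m ^ n)))

code≡fromDigits : ∀ {p q} (X : Matrix p q) → RowNormalized X →
                  code X ≡ + fromDigits (2 ^ q ∸ 1) (rowcodeℕ X)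
code≡fromDigits {q = q} X X≥0 = begin
  sumℤ (λ i → ((+ (2 ^ q)) ℤ.- + 1) ℤ.^ toℕ i ℤ.* rowcode X i) ≡⟨ sumℤ-cong term ⟩
  sumℤ (λ i → + (B ^ toℕ i * rowcodeℕ X i))                   ≡⟨ sumℤ-+ (λ i → B ^ toℕ i * rowcodeℕ X i) ⟩
  + sumℕ (λ i → B ^ toℕ i * rowcodeℕ X i)                     ≡⟨ cong +_ (sumℕ-powers≡fromDigits B (rowcodeℕ X)) ⟩
  + fromDigits B (rowcodeℕ X)                                  ∎
  where
  open ≡-Reasoning
  B = 2 ^ q ∸ 1
  base : (+ (2 ^ q)) ℤ.- + 1 ≡ + B
  base = trans (ℤP.m-n≡m⊖n (2 ^ q) 1) (ℤP.⊖-≥ (m^n>0 2 q))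
  term : ∀ i → ((+ (2 ^ q)) ℤ.- + 1) ℤ.^ toℕ i ℤ.* rowcode X i ≡ + (B ^ toℕ i * rowcodeℕ X i)
  term i = begin
    ((+ (2 ^ q)) ℤ.- + 1) ℤ.^ toℕ i ℤ.* rowcode X i ≡⟨ cong₂ ℤ._*_ (cong (ℤ._^ toℕ i) base) (sym (+rowcodeℕ X X≥0 i)) ⟩
    (+ B) ℤ.^ toℕ i ℤ.* + rowcodeℕ X i             ≡⟨ cong (ℤ._* + rowcodeℕ X i) (pos-^ B (toℕ i)) ⟩
    + (B ^ toℕ i) ℤ.* + rowcodeℕ X i               ≡⟨ ℤP.pos-* (B ^ toℕ i) (rowcodeℕ X i) ⟨
    + (B ^ toℕ i * rowcodeℕ X i)                   ∎

rowsum≡sumℕ : ∀ {p q} (X : Matrix p q) → RowNormalized X → rowsum X ≡ + sumℕ (rowcodeℕ X)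
rowsum≡sumℕ X X≥0 = trans (sumℤ-cong (λ i → sym (+rowcodeℕ X X≥0 i))) (sumℤ-+ (rowcodeℕ X))

binaryDigits : ∀ {p q} (E : Matrix p (suc q)) → Binary E → ∀ i → Digits 2 (tail (E i))
binaryDigits E E≤1 i k = s≤s (E≤1 i (F.suc k))

rowcodeℕ-< : ∀ {p q} (E : Matrix p (suc q)) → Binary E → RowNormalized E →
             ∀ i → rowcodeℕ E i < 2 ^ suc q ∸ 1
rowcodeℕ-< {q = q} E E≤1 E≥0 i = ∸-monoˡ-≤ 1 (begin
  2 + rowcodeℕ E i ≤⟨ +-monoʳ-≤ 2 (≤-trans (m≤m+n _ (E i F.zero)) (≤-reflexive (rowcodeℕ-+-col0 E E≥0 i))) ⟩
  2 + 2 * v        ≡⟨ *-suc 2 v ⟨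
  2 * suc v        ≤⟨ *-monoʳ-≤ 2 (fromDigits-< (binaryDigits E E≤1 i)) ⟩
  2 * 2 ^ q        ∎)
  where
  open ≤-Reasoning
  v = rowValue E i

rowcodes-agree : ∀ {p q} (E M : Matrix p (suc (suc q))) → Binary E → RowNormalized E → RowNormalized M →
                 rowsum M ≡ rowsum E → code M ≡ code E → ∀ i → rowcodeℕ M i ≡ rowcodeℕ E i
rowcodes-agree {q = q} E M E≤1 E≥0 M≥0 rowsum≡ code≡ =
  digits-unique 2≤base (rowcodeℕ-< E E≤1 E≥0) value≡ (≤-reflexive digitSum≡)
  where
  2≤base : 2 ≤ 2 ^ suc (suc q) ∸ 1
  2≤base = ∸-monoˡ-≤ 1 (≤-trans (n≤1+n 3) (*-monoʳ-≤ 2 (*-monoʳ-≤ 2 (m^n>0 2 q))))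
  value≡ : fromDigits (2 ^ suc (suc q) ∸ 1) (rowcodeℕ M) ≡ fromDigits (2 ^ suc (suc q) ∸ 1) (rowcodeℕ E)
  value≡ = ℤP.+-injective (trans (sym (code≡fromDigits M M≥0)) (trans code≡ (code≡fromDigits E E≥0)))
  digitSum≡ : sumℕ (rowcodeℕ M) ≡ sumℕ (rowcodeℕ E)
  digitSum≡ = ℤP.+-injective (trans (sym (rowsum≡sumℕ M M≥0)) (trans rowsum≡ (rowsum≡sumℕ E E≥0)))

firstColumns-agree : ∀ {p q} (E M : Matrix p (suc q)) → Binary E → RowNormalized E → RowNormalized M →
                     (∀ i → rowcodeℕ M i ≡ rowcodeℕ E i) → colweight M F.zero ≡ colweight E F.zero →
                     ∀ i → E i F.zero ≡ M i F.zero
firstColumns-agree E M E≤1 E≥0 M≥0 rowcode≡ colweight≡ = ≤-sumℕ-≡⇒≡ E₀≤M₀ (sym colweight≡)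
  where
  swap : ∀ a r b → a + (r + b) ≡ b + (r + a)
  swap = solve-∀
  E₀≤M₀ : ∀ i → E i F.zero ≤ M i F.zero
  E₀≤M₀ i = ≡-mod⇒≤ (rowValue M i) (rowValue E i) (s≤s (E≤1 i F.zero)) (begin
    E₀ + rowValue M i * 2      ≡⟨ cong (_+_ E₀) (trans (*-comm (rowValue M i) 2) (sym (rowcodeℕ-+-col0 M M≥0 i))) ⟩
    E₀ + (rowcodeℕ M i + M₀)   ≡⟨ cong (λ r → E₀ + (r + M₀)) (rowcode≡ i) ⟩
    E₀ + (rowcodeℕ E i + M₀)   ≡⟨ swap E₀ (rowcodeℕ E i) M₀ ⟩
    M₀ + (rowcodeℕ E i + E₀)   ≡⟨ cong (_+_ M₀) (trans (rowcodeℕ-+-col0 E E≥0 i) (*-comm 2 (rowValue E i))) ⟩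
    M₀ + rowValue E i * 2      ∎)
    where
    open ≡-Reasoning
    E₀ = E i F.zero
    M₀ = M i F.zero

rowValues-agree : ∀ {p q} (E M : Matrix p (suc q)) → RowNormalized E → RowNormalized M →
                  (∀ i → rowcodeℕ M i ≡ rowcodeℕ E i) → (∀ i → E i F.zero ≡ M i F.zero) →
                  ∀ i → rowValue M i ≡ rowValue E i
rowValues-agree E M E≥0 M≥0 rowcode≡ col0≡ i = *-cancelˡ-≡ (rowValue M i) (rowValue E i) 2 (begin
  2 * rowValue M i          ≡⟨ rowcodeℕ-+-col0 M M≥0 i ⟨
  rowcodeℕ M i + M i F.zero ≡⟨ cong₂ _+_ (rowcode≡ i) (sym (col0≡ i)) ⟩
  rowcodeℕ E i + E i F.zero ≡⟨ rowcodeℕ-+-col0 E E≥0 i ⟩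
  2 * rowValue E i          ∎)
  where open ≡-Reasoning

tails-agree : ∀ {p q} (E M : Matrix p (suc q)) → Binary E → (∀ i → rowValue M i ≡ rowValue E i) →
              (∀ i → E i F.zero ≡ M i F.zero) → weight M ≡ weight E →
              ∀ i k → M i (F.suc k) ≡ E i (F.suc k)
tails-agree E M E≤1 value≡ col0≡ weight≡ i =
  digits-unique ≤-refl (binaryDigits E E≤1 i) (value≡ i) (≤-reflexive (sym (tailSum≡ i)))
  where
  tailSum≤ : ∀ i → sumℕ (tail (E i)) ≤ sumℕ (tail (M i))
  tailSum≤ i = digitSum-minimal ≤-refl (binaryDigits E E≤1 i) (value≡ i)
  rowSum≡ : ∀ i → sumℕ (E i) ≡ sumℕ (M i)
  rowSum≡ = ≤-sumℕ-≡⇒≡ (λ i → +-mono-≤ (≤-reflexive (col0≡ i)) (tailSum≤ i)) (sym weight≡)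
  tailSum≡ : ∀ i → sumℕ (tail (E i)) ≡ sumℕ (tail (M i))
  tailSum≡ i = +-cancelˡ-≡ (E i F.zero) _ _ (trans (rowSum≡ i) (cong (_+ sumℕ (tail (M i))) (sym (col0≡ i))))

mainTheorem2 : (p q : ℕ) → p ≥ 1 → q ≥ 2 →
    (E M : Matrix p q) →
    Binary E → RowNormalized E → RowNormalized M →
    colweight0 M ≡ colweight0 E →
    weight M ≡ weight E →
    rowsum M ≡ rowsum E →
    code M ≡ code E →
    ∀ i j → M i j ≡ E i j
mainTheorem2 p (suc (suc q)) _ (s≤s (s≤s _)) E M E≤1 E≥0 M≥0 colweight≡ weight≡ rowsum≡ code≡ = entries≡
  where
  rowcode≡ : ∀ i → rowcodeℕ M i ≡ rowcodeℕ E i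
  rowcode≡ = rowcodes-agree E M E≤1 E≥0 M≥0 rowsum≡ code≡
  col0≡ : ∀ i → E i F.zero ≡ M i F.zero
  col0≡ = firstColumns-agree E M E≤1 E≥0 M≥0 rowcode≡ colweight≡
  entries≡ : ∀ i j → M i j ≡ E i j
  entries≡ i F.zero    = sym (col0≡ i)
  entries≡ i (F.suc k) =
    tails-agree E M E≤1 (rowValues-agree E M E≥0 M≥0 rowcode≡ col0≡) col0≡ weight≡ i k
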